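{- Let $m$ be a nonnegative integer and suppose $2m+1 = k(w^2+x^2+y^2+z^2)$ with $k,w,x,y,z\in\mathbb{Z}$. Then there exists $v\in\mathbb{Z}$ such that $$2T_m = k^2(wy+xz)^2 + k^2(wz-xy)^2 + 2T_v.$$
   Context: For $x\in\mathbb{Z}$, the triangular number $T_x$ is $T_x = x(x+1)/2$. -}

module Defs where

open import Data.Integer using (ℤ; _+_; _*_; +_)
open import Data.Integer.DivMod using (_/_)

-- Triangular number T_x = x(x+1)/2 for x ∈ ℤ (x(x+1) is always even, so the division is exact).
T : ℤ → ℤ
T x = (x * (x + + 1)) / + 2

{-# OPTIONS --safe #-}
-- Put N = 2m+1 = kS with S = P + Q, P = w² + x², Q = y² + z², and v = m - kQ, so that 2v+1 = N - 2kQ.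
-- Then m(m+1) - v(v+1) = kQ(N - kQ) = k²PQ, and PQ = (wy+xz)² + (wz-xy)² is the two-squares identity.
-- Since 2T_x = x(x+1) for every integer x, this is the claim.
module Submission where

open import Defs
open import Data.Nat as ℕ using (ℕ; zero; suc)
import Data.Nat.Properties as ℕₚ
open import Data.Nat.Divisibility using (_∣_; ∣m∣n⇒∣m+n; m∣m*n; _∣0)
open import Data.Nat.DivMod using (m/n*n≡m)
open import Data.Nat.Tactic.RingSolver as ℕ-Solver using ()
open import Data.Integer using (ℤ; _+_; _*_; _-_; -_; +_; -[1+_])
open import Data.Integer.DivMod using (_/_; div-pos-is-/ℕ)
open import Data.Integer.Properties using (pos-*)
open import Data.Integer.Tactic.RingSolver using (solve-∀)
open import Data.Product using (∃; _,_)
open import Relation.Binary.PropositionalEquality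
open ≡-Reasoning

2∣n*[n+1] : ∀ n → 2 ∣ n ℕ.* (n ℕ.+ 1)
2∣n*[n+1] zero    = 2 ∣0
2∣n*[n+1] (suc n) =
  subst (2 ∣_) (next-pronic n) (∣m∣n⇒∣m+n (2∣n*[n+1] n) (m∣m*n (suc n)))
  where
  next-pronic : ∀ n → n ℕ.* (n ℕ.+ 1) ℕ.+ 2 ℕ.* suc n ≡ suc n ℕ.* (suc n ℕ.+ 1)
  next-pronic = ℕ-Solver.solve-∀

2*T[+n] : ∀ n → + 2 * T (+ n) ≡ + n * (+ n + + 1)
2*T[+n] n = begin
  + 2 * ((+ n * + (n ℕ.+ 1)) / + 2)   ≡⟨ cong (λ p → + 2 * (p / + 2)) (pos-* n (n ℕ.+ 1)) ⟨
  + 2 * (+ pronic / + 2)              ≡⟨ cong (+ 2 *_) (div-pos-is-/ℕ (+ pronic) 2) ⟩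
  + 2 * + (pronic ℕ./ 2)              ≡⟨ pos-* 2 (pronic ℕ./ 2) ⟨
  + (2 ℕ.* (pronic ℕ./ 2))            ≡⟨ cong +_ (ℕₚ.*-comm 2 (pronic ℕ./ 2)) ⟩
  + (pronic ℕ./ 2 ℕ.* 2)              ≡⟨ cong +_ (m/n*n≡m (2∣n*[n+1] n)) ⟩
  + pronic                            ≡⟨ pos-* n (n ℕ.+ 1) ⟩
  + n * (+ n + + 1)                   ∎
  where
  pronic : ℕ
  pronic = n ℕ.* (n ℕ.+ 1)

pronic-reflect : ∀ a → - (+ 1 + a) * (- (+ 1 + a) + + 1) ≡ a * (a + + 1)
pronic-reflect = solve-∀

2*T : ∀ x → + 2 * T x ≡ x * (x + + 1)
2*T (+ n)    = 2*T[+n] n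
2*T -[1+ n ] = begin
  + 2 * T -[1+ n ]              ≡⟨ cong (λ p → + 2 * (p / + 2)) (pronic-reflect (+ n)) ⟩
  + 2 * T (+ n)                 ≡⟨ 2*T[+n] n ⟩
  + n * (+ n + + 1)             ≡⟨ pronic-reflect (+ n) ⟨
  -[1+ n ] * (-[1+ n ] + + 1)   ∎

pronic-shift : ∀ n c → n * (n + + 1) ≡ c * ((+ 2 * n + + 1) - c) + (n - c) * ((n - c) + + 1)
pronic-shift = solve-∀

scaled-two-squares : ∀ k w x y z →
  k * (y * y + z * z) * (k * (w * w + x * x + y * y + z * z) - k * (y * y + z * z))
    ≡ (k * k) * ((w * y + x * z) * (w * y + x * z)) + (k * k) * ((w * z - x * y) * (w * z - x * y))
scaled-two-squares = solve-∀

lemma3p1 : (m : ℕ) (k w x y z : ℤ) →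
    + 2 * + m + + 1 ≡ k * (w * w + x * x + y * y + z * z) →
    ∃ λ (v : ℤ) →
      + 2 * T (+ m) ≡ (k * k) * ((w * y + x * z) * (w * y + x * z))
                     + (k * k) * ((w * z - x * y) * (w * z - x * y))
                     + + 2 * T v
lemma3p1 m k w x y z 2m+1≡kS = v , (begin
  + 2 * T (+ m)                                  ≡⟨ 2*T (+ m) ⟩
  + m * (+ m + + 1)                              ≡⟨ pronic-shift (+ m) c ⟩
  c * ((+ 2 * + m + + 1) - c) + v * (v + + 1)    ≡⟨ cong (λ N → c * (N - c) + v * (v + + 1)) 2m+1≡kS ⟩
  c * (k * S - c) + v * (v + + 1)                ≡⟨ cong₂ _+_ (scaled-two-squares k w x y z) (sym (2*T v)) ⟩
  (k * k) * ((w * y + x * z) * (w * y + x * z))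
    + (k * k) * ((w * z - x * y) * (w * z - x * y))
    + + 2 * T v                                  ∎)
  where
  S c v : ℤ
  S = w * w + x * x + y * y + z * z
  c = k * (y * y + z * z)
  v = + m - c
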